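{- Let $M$ be a positive unital commutative lattice-ordered monoid and $x\in M$. Then there exists exactly one good sequence $(x_0,x_1,x_2,\dots)$ in $U(M)$ such that $x=x_0+\dots+x_m$ for $m$ with $x_i=0$ for all $i>m$, and it is given by $x_n=(x\ominus n)\wedge1$. In particular, the map $\varepsilon^1_M\colon\mathrm{GS}(U(M))\to M$, $(x_0,\dots,x_m,0,0,\dots)\mapsto x_0+\dots+x_m$, is bijective.
   Context: A positive unital commutative lattice-ordered monoid is an algebra $\langle M;+,\vee,\wedge,0,1,-\ominus1\rangle$ (arities $2,2,2,0,0,1$) such that $\langle M;\vee,\wedge\rangle$ is a distributive lattice, $\langle M;+,0\rangle$ is a commutative monoid, $+$ distributes over $\vee$ and $\wedge$, and for all $x\in M$: $x\ge0$; $(x+1)\ominus1=x$; $(x\ominus1)+1=x\vee1$; $x\le1+\dots+1$ for some finite number of summands. Inductively, $x\ominus0=x$ and $x\ominus n=(x\ominus(n-1))\ominus1$ for $n\ge1$. $U(M)=\{x\in M\mid x\le1\}$ with $\vee,\wedge,0,1$ restricted and $x\oplus y=(x+y)\wedge1$, $x\odot y=(x+y)\ominus1$. A good pair in $U(M)$ is $(x_0,x_1)$ with $x_0\oplus x_1=x_0$ and $x_0\odot x_1=x_1$; a good sequence in $U(M)$ is a sequence of elements of $U(M)$, eventually $0$, in which every pair of consecutive terms is a good pair; $\mathrm{GS}(U(M))$ denotes the set of good sequences in $U(M)$. -}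

module Defs where

open import Level using (Level; suc; _⊔_)
open import Data.Nat as ℕ using (ℕ; zero; _<_) renaming (suc to 1+)
open import Data.Product using (Σ; ∃; _×_; _,_)
open import Relation.Binary.PropositionalEquality using (_≡_)
open import Algebra.Core using (Op₁; Op₂)
import Algebra.Definitions as Defns
import Algebra.Structures as Str
import Algebra.Lattice.Structures as LStr

copies : ∀ {c} {A : Set c} → Op₂ A → A → A → ℕ → A
copies _+_ z o zero = z
copies _+_ z o (1+ n) = copies _+_ z o n + o

record PUCLMonoid (c : Level) : Set (suc c) where
  infixl 6 _+_
  infixr 7 _∧_
  infixr 6 _∨_
  field
    Carrier : Set c
    _+_     : Op₂ Carrier
    _∨_     : Op₂ Carrier
    _∧_     : Op₂ Carrier
    𝟘       : Carrier
    𝟙       : Carrier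
    _⊖1     : Op₁ Carrier

  field
    isDistributiveLattice : LStr.IsDistributiveLattice {A = Carrier} _≡_ _∨_ _∧_
    isCommutativeMonoid   : Str.IsCommutativeMonoid {A = Carrier} _≡_ _+_ 𝟘
    +-distrib-∨ : Defns._DistributesOver_ {A = Carrier} _≡_ _+_ _∨_
    +-distrib-∧ : Defns._DistributesOver_ {A = Carrier} _≡_ _+_ _∧_
    positive    : ∀ x → 𝟘 ∧ x ≡ 𝟘
    ⊖1-+1       : ∀ x → (x + 𝟙) ⊖1 ≡ x
    +1-⊖1       : ∀ x → (x ⊖1) + 𝟙 ≡ x ∨ 𝟙
    bounded     : ∀ x → ∃ λ n → x ∧ copies _+_ 𝟘 𝟙 n ≡ x

  _≤_ : Carrier → Carrier → Set c
  x ≤ y = x ∧ y ≡ x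

  copies1 : ℕ → Carrier
  copies1 zero = 𝟘
  copies1 (1+ n) = copies1 n + 𝟙


  _⊖_ : Carrier → ℕ → Carrier
  x ⊖ zero = x
  x ⊖ 1+ n = (x ⊖ n) ⊖1

  InU : Carrier → Set c
  InU x = x ≤ 𝟙

  _⊕_ : Op₂ Carrier
  x ⊕ y = (x + y) ∧ 𝟙

  _⊙_ : Op₂ Carrier
  x ⊙ y = (x + y) ⊖1

  GoodPair : Carrier → Carrier → Set c
  GoodPair x₀ x₁ = (x₀ ⊕ x₁ ≡ x₀) × (x₀ ⊙ x₁ ≡ x₁)

  ZeroBeyond : (ℕ → Carrier) → ℕ → Set c
  ZeroBeyond s m = ∀ i → m < i → s i ≡ 𝟘

  IsGoodSeq : (ℕ → Carrier) → Set c
  IsGoodSeq s = (∀ i → InU (s i))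
              × (∀ i → GoodPair (s i) (s (1+ i)))
              × ∃ (ZeroBeyond s)

  partialSum : (ℕ → Carrier) → ℕ → Carrier
  partialSum s zero = s zero
  partialSum s (1+ m) = partialSum s m + s (1+ m)

  record GS : Set c where
    field
      seq      : ℕ → Carrier
      inU      : ∀ i → InU (seq i)
      good     : ∀ i → GoodPair (seq i) (seq (1+ i))
      bound    : ℕ
      vanishes : ZeroBeyond seq bound

  ε¹ : GS → Carrier
  ε¹ g = partialSum (GS.seq g) (GS.bound g)

-- Every x splits as x = (x ∧ 1) + (x ⊖ 1). Iterating, x is the sum of the sequence
-- (x ⊖ n) ∧ 1, which vanishes eventually because x ≤ 1 + … + 1 and each ⊖ 1 strips
-- one summand 1; the same splitting makes consecutive terms good pairs. Conversely,
-- if (a, b) is a good pair and T ∧ 1 = b, then (a + T) ∧ 1 = a and (a + T) ⊖ 1 = T.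
-- Applied to the tail sums of a good sequence with sum x, this shows inductively
-- that the n-th tail sum is x ⊖ n, so the n-th term is (x ⊖ n) ∧ 1.
module Submission where

open import Defs
open import Level using (Level)
open import Data.Nat using (ℕ)
open import Data.Product using (∃; _×_; _,_)
open import Relation.Binary.PropositionalEquality using (_≡_)

import Data.Nat as ℕ
import Data.Nat.Properties as ℕ
open import Data.Product using (proj₁; proj₂)
open import Function using (_∘_)
open import Relation.Binary.PropositionalEquality
  using (refl; sym; trans; cong; cong₂; module ≡-Reasoning)
open import Algebra.Lattice.Bundles using (Lattice)
import Algebra.Lattice.Structures as LStr
import Algebra.Structures as Str
import Algebra.Lattice.Properties.Lattice as LatticeProperties
import Relation.Binary.Lattice as OrderLattice
import Relation.Binary.Lattice.Properties.MeetSemilattice as MeetSemilatticeProperties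
import Relation.Binary.Lattice.Properties.JoinSemilattice as JoinSemilatticeProperties
import Relation.Binary.Reasoning.PartialOrder as ≤-Reasoning

module PUCLMonoidProperties {c : Level} (M : PUCLMonoid c) where
  open PUCLMonoid M hiding (_≤_)
  open LStr.IsDistributiveLattice isDistributiveLattice
    using (isLattice; ∧-comm; ∧-assoc; ∨-distribʳ-∧)
  open Str.IsCommutativeMonoid isCommutativeMonoid
    using (assoc; comm; identityˡ; identityʳ)

  lattice : Lattice c c
  lattice = record { isLattice = isLattice }

  orderLattice : OrderLattice.Lattice c c c
  orderLattice = LatticeProperties.∨-∧-orderTheoreticLattice lattice

  -- The library's lattice order is x ≡ x ∧ y, the symmetric form of the one in Defs.
  open OrderLattice.Lattice orderLattice
    using (_≤_; x≤x∨y; ∨-least; x∧y≤x; x∧y≤y; ∧-greatest; poset)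
    renaming (refl to ≤-refl; reflexive to ≤-reflexive; trans to ≤-trans; antisym to ≤-antisym)
  open MeetSemilatticeProperties (OrderLattice.Lattice.meetSemilattice orderLattice)
    using (∧-monotonic)
  open JoinSemilatticeProperties (OrderLattice.Lattice.joinSemilattice orderLattice)
    using (∨-monotonic)

  +-distribˡ-∧ : ∀ x y z → x + (y ∧ z) ≡ (x + y) ∧ (x + z)
  +-distribˡ-∧ = proj₁ +-distrib-∧

  +-distribʳ-∧ : ∀ x y z → (y ∧ z) + x ≡ (y + x) ∧ (z + x)
  +-distribʳ-∧ = proj₂ +-distrib-∧

  +-distribˡ-∨ : ∀ x y z → x + (y ∨ z) ≡ (x + y) ∨ (x + z)
  +-distribˡ-∨ = proj₁ +-distrib-∨

  ≤1⇒InU : ∀ {x} → x ≤ 𝟙 → InU x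
  ≤1⇒InU = sym

  0≤x : ∀ x → 𝟘 ≤ x
  0≤x x = sym (positive x)

  x≤0⇒x≡0 : ∀ {x} → x ≤ 𝟘 → x ≡ 𝟘
  x≤0⇒x≡0 {x} x≤0 = ≤-antisym x≤0 (0≤x x)

  +-monoʳ-≤ : ∀ x {y z} → y ≤ z → x + y ≤ x + z
  +-monoʳ-≤ x {y} {z} y≤z = trans (cong (x +_) y≤z) (+-distribˡ-∧ x y z)

  +-monoˡ-≤ : ∀ x {y z} → y ≤ z → y + x ≤ z + x
  +-monoˡ-≤ x {y} {z} y≤z = trans (cong (_+ x) y≤z) (+-distribʳ-∧ x y z)

  x≤x+y : ∀ x y → x ≤ x + y
  x≤x+y x y = ≤-trans (≤-reflexive (sym (identityʳ x))) (+-monoʳ-≤ x (0≤x y))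

  y≤x+y : ∀ x y → y ≤ x + y
  y≤x+y x y = ≤-trans (x≤x+y y x) (≤-reflexive (comm y x))

  +1-injective : ∀ {x y} → x + 𝟙 ≡ y + 𝟙 → x ≡ y
  +1-injective {x} {y} eq = trans (sym (⊖1-+1 x)) (trans (cong _⊖1 eq) (⊖1-+1 y))

  ⊖1-distrib-∧ : ∀ x y → (x ∧ y) ⊖1 ≡ x ⊖1 ∧ y ⊖1
  ⊖1-distrib-∧ x y = +1-injective (begin
    (x ∧ y) ⊖1 + 𝟙               ≡⟨ +1-⊖1 (x ∧ y) ⟩
    (x ∧ y) ∨ 𝟙                  ≡⟨ ∨-distribʳ-∧ 𝟙 x y ⟩
    (x ∨ 𝟙) ∧ (y ∨ 𝟙)            ≡⟨ sym (cong₂ _∧_ (+1-⊖1 x) (+1-⊖1 y)) ⟩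
    (x ⊖1 + 𝟙) ∧ (y ⊖1 + 𝟙)      ≡⟨ sym (+-distribʳ-∧ 𝟙 (x ⊖1) (y ⊖1)) ⟩
    (x ⊖1 ∧ y ⊖1) + 𝟙            ∎)
    where open ≡-Reasoning

  ⊖1-mono-≤ : ∀ {x y} → x ≤ y → x ⊖1 ≤ y ⊖1
  ⊖1-mono-≤ {x} {y} x≤y = trans (cong _⊖1 x≤y) (⊖1-distrib-∧ x y)

  ≤+1⇒⊖1≤ : ∀ {x y} → x ≤ y + 𝟙 → x ⊖1 ≤ y
  ≤+1⇒⊖1≤ {x} {y} x≤y+1 = ≤-trans (⊖1-mono-≤ x≤y+1) (≤-reflexive (⊖1-+1 y))

  ⊖1≤⇒≤+1 : ∀ {x y} → x ⊖1 ≤ y → x ≤ y + 𝟙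
  ⊖1≤⇒≤+1 {x} {y} x⊖1≤y = begin
    x           ≤⟨ x≤x∨y x 𝟙 ⟩
    x ∨ 𝟙       ≡⟨ sym (+1-⊖1 x) ⟩
    x ⊖1 + 𝟙    ≤⟨ +-monoˡ-≤ 𝟙 x⊖1≤y ⟩
    y + 𝟙       ∎
    where open ≤-Reasoning poset

  +1-cancel-≤ : ∀ {x y} → x + 𝟙 ≤ y + 𝟙 → x ≤ y
  +1-cancel-≤ {x} x+1≤y+1 = ≤-trans (≤-reflexive (sym (⊖1-+1 x))) (≤+1⇒⊖1≤ x+1≤y+1)

  +1≤∨1⇒≤⊖1 : ∀ {x y} → y + 𝟙 ≤ x ∨ 𝟙 → y ≤ x ⊖1
  +1≤∨1⇒≤⊖1 {x} y+1≤x∨1 = +1-cancel-≤ (≤-trans y+1≤x∨1 (≤-reflexive (sym (+1-⊖1 x))))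

  x⊖1≤x : ∀ x → x ⊖1 ≤ x
  x⊖1≤x x = ≤+1⇒⊖1≤ (x≤x+y x 𝟙)

  x+y⊖1≤x : ∀ x {y} → y ≤ 𝟙 → (x + y) ⊖1 ≤ x
  x+y⊖1≤x x y≤1 = ≤+1⇒⊖1≤ (+-monoʳ-≤ x y≤1)

  ≤1⇒⊖1≡0 : ∀ {x} → x ≤ 𝟙 → x ⊖1 ≡ 𝟘
  ≤1⇒⊖1≡0 {x} x≤1 = x≤0⇒x≡0 (≤+1⇒⊖1≤ (≤-trans x≤1 (≤-reflexive (sym (identityˡ 𝟙)))))

  0⊖1≡0 : 𝟘 ⊖1 ≡ 𝟘
  0⊖1≡0 = ≤1⇒⊖1≡0 (0≤x 𝟙)

  ∧1+⊖1 : ∀ x → x ∧ 𝟙 + x ⊖1 ≡ x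
  ∧1+⊖1 x = ≤-antisym ∧1+⊖1≤x x≤∧1+⊖1
    where
    open ≤-Reasoning poset
    x≤∧1+⊖1 : x ≤ x ∧ 𝟙 + x ⊖1
    x≤∧1+⊖1 = begin
      x                            ≤⟨ ∧-greatest (x≤x+y x (x ⊖1)) (x≤x∨y x 𝟙) ⟩
      (x + x ⊖1) ∧ (x ∨ 𝟙)         ≡⟨ cong ((x + x ⊖1) ∧_) (trans (sym (+1-⊖1 x)) (comm (x ⊖1) 𝟙)) ⟩
      (x + x ⊖1) ∧ (𝟙 + x ⊖1)      ≡⟨ sym (+-distribʳ-∧ (x ⊖1) x 𝟙) ⟩
      x ∧ 𝟙 + x ⊖1                 ∎
    ∧1+⊖1≤x : x ∧ 𝟙 + x ⊖1 ≤ x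
    ∧1+⊖1≤x = +1-cancel-≤ (begin
      x ∧ 𝟙 + x ⊖1 + 𝟙                 ≡⟨ assoc (x ∧ 𝟙) (x ⊖1) 𝟙 ⟩
      x ∧ 𝟙 + (x ⊖1 + 𝟙)               ≡⟨ cong (x ∧ 𝟙 +_) (+1-⊖1 x) ⟩
      x ∧ 𝟙 + (x ∨ 𝟙)                  ≡⟨ +-distribˡ-∨ (x ∧ 𝟙) x 𝟙 ⟩
      (x ∧ 𝟙 + x) ∨ (x ∧ 𝟙 + 𝟙)        ≤⟨ ∨-least (≤-trans (+-monoˡ-≤ x (x∧y≤y x 𝟙)) (≤-reflexive (comm 𝟙 x)))
                                                  (+-monoˡ-≤ 𝟙 (x∧y≤x x 𝟙)) ⟩
      x + 𝟙                            ∎)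

  ∧1-⊖1∧1-goodPair : ∀ x → GoodPair (x ∧ 𝟙) (x ⊖1 ∧ 𝟙)
  ∧1-⊖1∧1-goodPair x = ⊕-absorbs , ⊙-absorbs
    where
    a = x ∧ 𝟙
    ⊕-absorbs : (a + x ⊖1 ∧ 𝟙) ∧ 𝟙 ≡ a
    ⊕-absorbs = ≤-antisym
      (∧-monotonic (≤-trans (+-monoʳ-≤ a (x∧y≤x (x ⊖1) 𝟙)) (≤-reflexive (∧1+⊖1 x))) ≤-refl)
      (∧-greatest (x≤x+y a (x ⊖1 ∧ 𝟙)) (x∧y≤y x 𝟙))
    ⊙-absorbs : (a + x ⊖1 ∧ 𝟙) ⊖1 ≡ x ⊖1 ∧ 𝟙
    ⊙-absorbs = begin
      (a + x ⊖1 ∧ 𝟙) ⊖1             ≡⟨ cong _⊖1 (+-distribˡ-∧ a (x ⊖1) 𝟙) ⟩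
      ((a + x ⊖1) ∧ (a + 𝟙)) ⊖1     ≡⟨ cong (λ t → (t ∧ (a + 𝟙)) ⊖1) (∧1+⊖1 x) ⟩
      (x ∧ (a + 𝟙)) ⊖1              ≡⟨ ⊖1-distrib-∧ x (a + 𝟙) ⟩
      x ⊖1 ∧ (a + 𝟙) ⊖1             ≡⟨ cong (x ⊖1 ∧_) (⊖1-+1 a) ⟩
      x ⊖1 ∧ (x ∧ 𝟙)                ≡⟨ sym (∧-assoc (x ⊖1) x 𝟙) ⟩
      (x ⊖1 ∧ x) ∧ 𝟙                ≡⟨ cong (_∧ 𝟙) (sym (x⊖1≤x x)) ⟩
      x ⊖1 ∧ 𝟙                      ∎
      where open ≡-Reasoning

  goodPair-+-∧1 : ∀ {a b} T → GoodPair a b → T ∧ 𝟙 ≡ b → (a + T) ∧ 𝟙 ≡ a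
  goodPair-+-∧1 {a} {b} T (a⊕b≡a , _) T∧1≡b = begin
    (a + T) ∧ 𝟙                  ≡⟨ cong ((a + T) ∧_) (y≤x+y a 𝟙) ⟩
    (a + T) ∧ (𝟙 ∧ (a + 𝟙))      ≡⟨ cong ((a + T) ∧_) (∧-comm 𝟙 (a + 𝟙)) ⟩
    (a + T) ∧ ((a + 𝟙) ∧ 𝟙)      ≡⟨ sym (∧-assoc (a + T) (a + 𝟙) 𝟙) ⟩
    ((a + T) ∧ (a + 𝟙)) ∧ 𝟙      ≡⟨ cong (_∧ 𝟙) (sym (+-distribˡ-∧ a T 𝟙)) ⟩
    (a + T ∧ 𝟙) ∧ 𝟙              ≡⟨ cong (λ t → (a + t) ∧ 𝟙) T∧1≡b ⟩
    (a + b) ∧ 𝟙                  ≡⟨ a⊕b≡a ⟩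
    a                            ∎
    where open ≡-Reasoning

  goodPair-+-⊖1 : ∀ {a b} T → GoodPair a b → T ∧ 𝟙 ≡ b → (a + T) ⊖1 ≡ T
  goodPair-+-⊖1 {a} {b} T (_ , a⊙b≡b) T∧1≡b = ≤-antisym ⊖1≤T T≤⊖1
    where
    open ≤-Reasoning poset
    b≤1 : b ≤ 𝟙
    b≤1 = ≤-trans (≤-reflexive (sym T∧1≡b)) (x∧y≤y T 𝟙)
    b≤T : b ≤ T
    b≤T = ≤-trans (≤-reflexive (sym T∧1≡b)) (x∧y≤x T 𝟙)
    b≤a : b ≤ a
    b≤a = ≤-trans (≤-reflexive (sym a⊙b≡b)) (x+y⊖1≤x a b≤1)
    T≡b+T⊖1 : T ≡ b + T ⊖1
    T≡b+T⊖1 = trans (sym (∧1+⊖1 T)) (cong (_+ T ⊖1) T∧1≡b)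
    ⊖1≤T : (a + T) ⊖1 ≤ T
    ⊖1≤T = ≤+1⇒⊖1≤ (begin
      a + T              ≡⟨ cong (a +_) T≡b+T⊖1 ⟩
      a + (b + T ⊖1)     ≡⟨ sym (assoc a b (T ⊖1)) ⟩
      a + b + T ⊖1       ≤⟨ +-monoˡ-≤ (T ⊖1) (⊖1≤⇒≤+1 (≤-reflexive a⊙b≡b)) ⟩
      b + 𝟙 + T ⊖1       ≡⟨ trans (assoc b 𝟙 (T ⊖1)) (cong (b +_) (comm 𝟙 (T ⊖1))) ⟩
      b + (T ⊖1 + 𝟙)     ≡⟨ trans (sym (assoc b (T ⊖1) 𝟙)) (cong (_+ 𝟙) (sym T≡b+T⊖1)) ⟩
      T + 𝟙              ∎)
    T≤⊖1 : T ≤ (a + T) ⊖1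
    T≤⊖1 = +1≤∨1⇒≤⊖1 (begin
      T + 𝟙                    ≡⟨ cong (_+ 𝟙) T≡b+T⊖1 ⟩
      b + T ⊖1 + 𝟙             ≡⟨ assoc b (T ⊖1) 𝟙 ⟩
      b + (T ⊖1 + 𝟙)           ≡⟨ cong (b +_) (+1-⊖1 T) ⟩
      b + (T ∨ 𝟙)              ≡⟨ +-distribˡ-∨ b T 𝟙 ⟩
      (b + T) ∨ (b + 𝟙)        ≡⟨ cong (λ t → (b + T) ∨ (t + 𝟙)) (sym a⊙b≡b) ⟩
      (b + T) ∨ (a ⊙ b + 𝟙)    ≡⟨ cong ((b + T) ∨_) (+1-⊖1 (a + b)) ⟩
      (b + T) ∨ ((a + b) ∨ 𝟙)  ≤⟨ ∨-least (≤-trans (+-monoˡ-≤ T b≤a) (x≤x∨y (a + T) 𝟙))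
                                          (∨-monotonic (+-monoʳ-≤ a b≤T) ≤-refl) ⟩
      (a + T) ∨ 𝟙              ∎)

  canonicalSeq : Carrier → ℕ → Carrier
  canonicalSeq x n = (x ⊖ n) ∧ 𝟙

  ⊖-suc : ∀ x n → x ⊖ ℕ.suc n ≡ (x ⊖1) ⊖ n
  ⊖-suc x ℕ.zero    = refl
  ⊖-suc x (ℕ.suc n) = cong _⊖1 (⊖-suc x n)

  ⊖-copies : ∀ n {x} → x ≤ copies _+_ 𝟘 𝟙 n → x ⊖ n ≡ 𝟘
  ⊖-copies ℕ.zero          x≤0   = x≤0⇒x≡0 x≤0
  ⊖-copies (ℕ.suc n) {x} x≤n+1 = trans (⊖-suc x n) (⊖-copies n (≤+1⇒⊖1≤ x≤n+1))

  ⊖-eventually-0 : ∀ x → ∃ λ n → x ⊖ n ≡ 𝟘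
  ⊖-eventually-0 x with bounded x
  ... | n , x≤n = n , ⊖-copies n (sym x≤n)

  ⊖-stays-0 : ∀ {x n i} → x ⊖ n ≡ 𝟘 → n ℕ.≤′ i → x ⊖ i ≡ 𝟘
  ⊖-stays-0 x⊖n≡0 ℕ.≤′-refl       = x⊖n≡0
  ⊖-stays-0 x⊖n≡0 (ℕ.≤′-step n≤i) = trans (cong _⊖1 (⊖-stays-0 x⊖n≡0 n≤i)) 0⊖1≡0

  canonicalSeq-zeroBeyond : ∀ {x n} → x ⊖ n ≡ 𝟘 → ZeroBeyond (canonicalSeq x) n
  canonicalSeq-zeroBeyond x⊖n≡0 i n<i =
    trans (cong (_∧ 𝟙) (⊖-stays-0 x⊖n≡0 (ℕ.≤⇒≤′ (ℕ.<⇒≤ n<i)))) (positive 𝟙)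

  canonicalSeq-isGoodSeq : ∀ x → IsGoodSeq (canonicalSeq x)
  canonicalSeq-isGoodSeq x =
    (λ i → ≤1⇒InU (x∧y≤y (x ⊖ i) 𝟙)) ,
    (λ i → ∧1-⊖1∧1-goodPair (x ⊖ i)) ,
    (proj₁ (⊖-eventually-0 x) , canonicalSeq-zeroBeyond (proj₂ (⊖-eventually-0 x)))

  partialSum-canonicalSeq : ∀ x k → partialSum (canonicalSeq x) k + x ⊖ ℕ.suc k ≡ x
  partialSum-canonicalSeq x ℕ.zero    = ∧1+⊖1 x
  partialSum-canonicalSeq x (ℕ.suc k) = begin
    partialSum (canonicalSeq x) k + y ∧ 𝟙 + y ⊖1    ≡⟨ assoc (partialSum (canonicalSeq x) k) (y ∧ 𝟙) (y ⊖1) ⟩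
    partialSum (canonicalSeq x) k + (y ∧ 𝟙 + y ⊖1)  ≡⟨ cong (partialSum (canonicalSeq x) k +_) (∧1+⊖1 y) ⟩
    partialSum (canonicalSeq x) k + y               ≡⟨ partialSum-canonicalSeq x k ⟩
    x                                               ∎
    where
    open ≡-Reasoning
    y = x ⊖ ℕ.suc k

  canonicalSeq-sum : ∀ x → ∃ λ m → ZeroBeyond (canonicalSeq x) m × partialSum (canonicalSeq x) m ≡ x
  canonicalSeq-sum x with ⊖-eventually-0 x
  ... | m , x⊖m≡0 = m , canonicalSeq-zeroBeyond x⊖m≡0 , (begin
    partialSum (canonicalSeq x) m                    ≡⟨ sym (identityʳ _) ⟩
    partialSum (canonicalSeq x) m + 𝟘                ≡⟨ cong (partialSum (canonicalSeq x) m +_) (sym x⊖1+m≡0) ⟩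
    partialSum (canonicalSeq x) m + x ⊖ ℕ.suc m      ≡⟨ partialSum-canonicalSeq x m ⟩
    x                                                ∎)
    where
    open ≡-Reasoning
    x⊖1+m≡0 : x ⊖ ℕ.suc m ≡ 𝟘
    x⊖1+m≡0 = trans (cong _⊖1 x⊖m≡0) 0⊖1≡0

  partialSum-suc : ∀ s m → partialSum s (ℕ.suc m) ≡ s 0 + partialSum (s ∘ ℕ.suc) m
  partialSum-suc s ℕ.zero    = refl
  partialSum-suc s (ℕ.suc m) =
    trans (cong (_+ s (ℕ.suc (ℕ.suc m))) (partialSum-suc s m)) (assoc _ _ _)

  partialSum-zeroBeyond : ∀ {s m} → ZeroBeyond s m → partialSum s (ℕ.suc m) ≡ partialSum s m
  partialSum-zeroBeyond {s} {m} zb =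
    trans (cong (partialSum s m +_) (zb (ℕ.suc m) (ℕ.n<1+n m))) (identityʳ _)

  zeroBeyond-suc : ∀ {s m} → ZeroBeyond s m → ZeroBeyond (s ∘ ℕ.suc) m
  zeroBeyond-suc zb i m<i = zb (ℕ.suc i) (ℕ.m<n⇒m<1+n m<i)

  InUSeq : (ℕ → Carrier) → Set c
  InUSeq s = ∀ i → InU (s i)

  GoodChain : (ℕ → Carrier) → Set c
  GoodChain s = ∀ i → GoodPair (s i) (s (ℕ.suc i))

  partialSum-∧1 : ∀ {s} → InUSeq s → GoodChain s → ∀ m → partialSum s m ∧ 𝟙 ≡ s 0
  partialSum-∧1     inU good ℕ.zero    = inU 0
  partialSum-∧1 {s} inU good (ℕ.suc m) = trans (cong (_∧ 𝟙) (partialSum-suc s m))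
    (goodPair-+-∧1 _ (good 0) (partialSum-∧1 (inU ∘ ℕ.suc) (good ∘ ℕ.suc) m))

  partialSum-⊖1 : ∀ {s} → InUSeq s → GoodChain s →
                  ∀ m → partialSum s (ℕ.suc m) ⊖1 ≡ partialSum (s ∘ ℕ.suc) m
  partialSum-⊖1 {s} inU good m = trans (cong _⊖1 (partialSum-suc s m))
    (goodPair-+-⊖1 _ (good 0) (partialSum-∧1 (inU ∘ ℕ.suc) (good ∘ ℕ.suc) m))

  goodSeq-unique : ∀ {s m x} → InUSeq s → GoodChain s → ZeroBeyond s m →
                   partialSum s m ≡ x → ∀ n → s n ≡ canonicalSeq x n
  goodSeq-unique {s} {m} inU good zb sum≡x ℕ.zero =
    trans (sym (partialSum-∧1 inU good m)) (cong (_∧ 𝟙) sum≡x)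
  goodSeq-unique {s} {m} {x} inU good zb sum≡x (ℕ.suc n) =
    trans (goodSeq-unique (inU ∘ ℕ.suc) (good ∘ ℕ.suc) (zeroBeyond-suc zb) tail≡x⊖1 n)
          (cong (_∧ 𝟙) (sym (⊖-suc x n)))
    where
    tail≡x⊖1 : partialSum (s ∘ ℕ.suc) m ≡ x ⊖1
    tail≡x⊖1 = trans (sym (partialSum-⊖1 inU good m))
                     (cong _⊖1 (trans (partialSum-zeroBeyond zb) sum≡x))

  GS-unique : ∀ (g : GS) {x} → ε¹ g ≡ x → ∀ n → GS.seq g n ≡ canonicalSeq x n
  GS-unique g = goodSeq-unique (GS.inU g) (GS.good g) (GS.vanishes g)

  canonicalGS : Carrier → GS
  canonicalGS x = record
    { seq      = canonicalSeq x
    ; inU      = proj₁ (canonicalSeq-isGoodSeq x)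
    ; good     = proj₁ (proj₂ (canonicalSeq-isGoodSeq x))
    ; bound    = proj₁ (canonicalSeq-sum x)
    ; vanishes = proj₁ (proj₂ (canonicalSeq-sum x))
    }

  ε¹-canonicalGS : ∀ x → ε¹ (canonicalGS x) ≡ x
  ε¹-canonicalGS x = proj₂ (proj₂ (canonicalSeq-sum x))

proposition8p13 : ∀ {c : Level} (M : PUCLMonoid c) → let open PUCLMonoid M in
    (∀ (x : Carrier) →
      IsGoodSeq (λ n → (x ⊖ n) ∧ 𝟙)
      × (∃ λ m → ZeroBeyond (λ n → (x ⊖ n) ∧ 𝟙) m × partialSum (λ n → (x ⊖ n) ∧ 𝟙) m ≡ x)
      × (∀ (s : ℕ → Carrier) (m : ℕ) → IsGoodSeq s → ZeroBeyond s m → partialSum s m ≡ x →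
           ∀ n → s n ≡ (x ⊖ n) ∧ 𝟙))
    × ((∀ (g h : GS) → ε¹ g ≡ ε¹ h → ∀ n → GS.seq g n ≡ GS.seq h n)
       × (∀ (x : Carrier) → ∃ λ (g : GS) → ε¹ g ≡ x))
proposition8p13 M =
  (λ x → canonicalSeq-isGoodSeq x , canonicalSeq-sum x ,
         λ { s m (inU , good , _) zb sum≡x → goodSeq-unique inU good zb sum≡x }) ,
  (λ g h ε¹g≡ε¹h n → trans (GS-unique g ε¹g≡ε¹h n) (sym (GS-unique h refl n))) ,
  (λ x → canonicalGS x , ε¹-canonicalGS x)
  where open PUCLMonoidProperties M
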